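{- Let $G$ be an $m\times m$ grid graph and let $e_1=(u_1,v_1)$ and $e_2=(u_2,v_2)$ be two edges of the $\alpha$-auxiliary graph $\widetilde{G}$ (in a common block). If $e_1$ and $e_2$ cross each other, then $\widetilde{G}$ also contains the edges $(u_1,v_2)$ and $(u_2,v_1)$.
   Context: An $m\times m$ grid graph is a directed graph on vertex set $\{0,\dots,m\}^2$ whose edges join vertices at Manhattan distance $1$. Fix $0<\alpha<1$ with $t=m^{1-\alpha}$ and $m^{\alpha}$ integers. For $1\le i,j\le m^{\alpha}$ the subgrid $G[i,j]$ is the subgraph of $G$ induced by $\{(i',j'): (i-1)t\le i'\le it,\ (j-1)t\le j'\le jt\}$. The block $l=\widetilde{G}[i,j]$ has as vertices the boundary vertices of this square, and $(u,v)$ is an edge of the block if there is a directed path from $u$ to $v$ inside $G[i,j]$. The $\alpha$-auxiliary graph $\widetilde{G}$ is the union of all blocks (edges shared by adjacent blocks kept as distinct parallel edges, one per block). For a vertex $v$ of block $l$, $c_l(v)$ is the next boundary vertex counter-clockwise along the square of $l$, $c_l^0(v)=v$, $c_l^{r+1}(v)=c_l(c_l^r(v))$, exponents taken as the smallest non-negative such integer. Two distinct edges $e,f$ of block $l$ with $e=(v,c_l^p(v))$ and $f=(c_l^q(v),c_l^r(v))$ cross each other if $\min(q,r)<p<\max(q,r)$. -}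

module Defs where

open import Data.Nat using (ℕ; zero; suc; _+_; _*_; _∸_; _≤_; _<_; ∣_-_∣; _⊔_; _⊓_)
open import Data.Product using (_×_; _,_; Σ; ∃; ∃-syntax)
open import Data.Sum using (_⊎_)
open import Relation.Binary.PropositionalEquality using (_≡_; _≢_)
open import Relation.Nullary using (¬_)
open import Relation.Binary.Construct.Closure.ReflexiveTransitive using (Star)

-- Vertices: pairs of naturals (x , y); the grid uses {0,…,m}².
V : Set
V = ℕ × ℕ

InRange : ℕ → V → Set
InRange m (x , y) = x ≤ m × y ≤ m

Manhattan : V → V → ℕ
Manhattan (x , y) (x′ , y′) = ∣ x - x′ ∣ + ∣ y - y′ ∣

-- An m×m grid graph: a directed graph on {0,…,m}² whose edges join
-- vertices at Manhattan distance 1 (any subset of such directed pairs).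
record GridGraph (m : ℕ) : Set₁ where
  field
    E  : V → V → Set
    wf : ∀ {u v} → E u v → InRange m u × InRange m v × Manhattan u v ≡ 1
open GridGraph public

-- Admissible block parameters: s = m^α, t = m^(1-α) integers for some
-- real 0 < α < 1, i.e. m = s * t and (s = t = 1, the case m = 1, or s,t ≥ 2).
Admissible : ℕ → ℕ → ℕ → Set
Admissible m s t = m ≡ s * t × ((s ≡ 1 × t ≡ 1) ⊎ (2 ≤ s × 2 ≤ t))

InSquare : ℕ → ℕ → ℕ → V → Set
InSquare a b t (x , y) = a ≤ x × x ≤ a + t × b ≤ y × y ≤ b + t

OnBoundary : ℕ → ℕ → ℕ → V → Set
OnBoundary a b t (x , y) =
  InSquare a b t (x , y) × (x ≡ a ⊎ x ≡ a + t ⊎ y ≡ b ⊎ y ≡ b + t)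

-- Corner of the subgrid G[i,j] (1 ≤ i,j ≤ s): ((i-1)t , (j-1)t).
cornerX : ℕ → ℕ → ℕ
cornerX t i = (i ∸ 1) * t

SubEdge : ∀ {m} → GridGraph m → ℕ → ℕ → ℕ → V → V → Set
SubEdge G t i j u v =
  E G u v × InSquare (cornerX t i) (cornerX t j) t u
          × InSquare (cornerX t i) (cornerX t j) t v

PathIn : ∀ {m} → GridGraph m → ℕ → ℕ → ℕ → V → V → Set
PathIn G t i j = Star (SubEdge G t i j)

BlockEdge : ∀ {m} → GridGraph m → ℕ → ℕ → ℕ → V → V → Set
BlockEdge G t i j u v =
  OnBoundary (cornerX t i) (cornerX t j) t u
  × OnBoundary (cornerX t i) (cornerX t j) t v
  × PathIn G t i j u v

AuxEdge : ∀ {m} → GridGraph m → ℕ → ℕ → V → V → Set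
AuxEdge G s t u v =
  ∃[ i ] ∃[ j ] (1 ≤ i × i ≤ s × 1 ≤ j × j ≤ s × BlockEdge G t i j u v)

-- c_l : next boundary vertex counter-clockwise on the square with
-- corner (a , b) and side t (as a functional relation):
-- bottom side rightwards, right side upwards, top side leftwards,
-- left side downwards.
data Next (a b t : ℕ) : V → V → Set where
  bot : ∀ x → a ≤ x → x < a + t → Next a b t (x , b) (suc x , b)
  rgt : ∀ y → b ≤ y → y < b + t → Next a b t (a + t , y) (a + t , suc y)
  top : ∀ x → a ≤ x → x < a + t → Next a b t (suc x , b + t) (x , b + t)
  lft : ∀ y → b ≤ y → y < b + t → Next a b t (a , suc y) (a , y)

data Pow (a b t : ℕ) : ℕ → V → V → Set where
  here  : ∀ {v} → Pow a b t zero v v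
  there : ∀ {p u v w} → Next a b t u v → Pow a b t p v w → Pow a b t (suc p) u w

Exp : ℕ → ℕ → ℕ → V → V → ℕ → Set
Exp a b t v w p = Pow a b t p v w × (∀ p′ → p′ < p → ¬ Pow a b t p′ v w)

-- Two distinct edges e = (v , c^p v), f = (c^q v , c^r v) of block
-- G̃[i,j] cross if min(q,r) < p < max(q,r).
Cross : ℕ → ℕ → ℕ → V × V → V × V → Set
Cross t i j (v , w) (x , y) =
  (v , w) ≢ (x , y) ×
  ∃[ p ] ∃[ q ] ∃[ r ]
    ( Exp (cornerX t i) (cornerX t j) t v w p
    × Exp (cornerX t i) (cornerX t j) t v x q
    × Exp (cornerX t i) (cornerX t j) t v y r
    × q ⊓ r < p × p < q ⊔ r )

-- Let e₁ = (u₁ , v₁) and e₂ = (u₂ , v₂) be crossing edges of the block G̃[i,j]: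
-- there are paths P : u₁ ⇝ v₁ and Q : u₂ ⇝ v₂ inside the subgrid G[i,j], all
-- four ends lie on the boundary of its square, and u₂, v₂ lie on different arcs
-- of the boundary cut at u₁ and v₁.  By a discrete Jordan curve argument P and
-- Q share a vertex z; splicing at z gives paths u₁ ⇝ z ⇝ v₂ and u₂ ⇝ z ⇝ v₁
-- inside G[i,j], i.e. the edges (u₁ , v₂) and (u₂ , v₁) of the same block.
--
-- The Jordan argument uses a winding parity ψ(z) of P at the vertices z of the
-- square: the parity of the number of edges of P crossing the half-line going
-- up from z + (½ , ½), corrected by fixed arcs joining the ends of P to infinity outside the
-- square.
--   (1) ψ is constant along unit steps avoiding P (Winding.ψ-path);
--   (2) at boundary vertices off P, ψ equals Ψ = boundaryParity (·) u₁ ⊕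
--       boundaryParity (·) v₁, which depends on the ends of P only
--       (Winding.ψ-boundary);
--   (3) walking counter-clockwise from u₁, Ψ flips exactly once, when the walk
--       reaches v₁ (BoundaryWalk.walk-parity).
-- If Q avoided P, (1) would give ψ(u₂) = ψ(v₂) while (2) and (3) give
-- ψ(u₂) ≠ ψ(v₂) (interleaved-paths-meet).

module Submission where

open import Defs
open import Level using (0ℓ)
open import Function using (_∘_)
open import Data.Nat using (ℕ; zero; suc; pred; _+_; _∸_; _≤_; _<_; _⊓_; _⊔_; s≤s; z≤n; z<s; _≟_; _≤?_; _<?_; ∣_-_∣)
open import Data.Nat.Properties
open import Data.Bool using (Bool; true; false; not; _∧_; _∨_; _xor_; if_then_else_)
open import Data.Bool.Properties using (xor-∧-commutativeRing; xor-same; xor-comm; xor-identityʳ; not-injective; ∧-comm; ∧-zeroʳ; ∧-identityʳ; ∨-zeroʳ; ∧-distribˡ-xor)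
open import Data.Maybe using (Maybe; just; nothing)
open import Data.Product using (_,_; _×_; proj₁; proj₂; ∃-syntax)
open import Data.Product.Properties using (≡-dec)
open import Data.Sum using (_⊎_; inj₁; inj₂)
open import Relation.Binary.PropositionalEquality
open import Relation.Nullary using (Dec; does; yes; no; ¬_; contradiction)
open import Relation.Binary.Construct.Closure.ReflexiveTransitive using (Star; _◅_; _◅◅_; ε)
open import Tactic.RingSolver using (solve-∀)
open import Tactic.RingSolver.Core.AlmostCommutativeRing using (AlmostCommutativeRing; fromCommutativeRing)

𝔹-ring : AlmostCommutativeRing 0ℓ 0ℓ
𝔹-ring = fromCommutativeRing xor-∧-commutativeRing is-false
  where
  is-false : ∀ x → Maybe (false ≡ x)
  is-false false = just refl
  is-false true  = nothing

xor-interchange : ∀ a b c d → (a xor b) xor (c xor d) ≡ (a xor c) xor (b xor d)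
xor-interchange = solve-∀ 𝔹-ring

xor-telescope : ∀ a b c → (a xor b) xor (b xor c) ≡ a xor c
xor-telescope = solve-∀ 𝔹-ring

∧false≡∧false : ∀ a b → a ∧ false ≡ b ∧ false
∧false≡∧false = solve-∀ 𝔹-ring

∧false≡xor∧false : ∀ a b c → a ∧ false ≡ (b ∧ false) xor (c ∧ false)
∧false≡xor∧false = solve-∀ 𝔹-ring

xor-self≡∧false : ∀ x y → (x xor x) ≡ (y ∧ false)
xor-self≡∧false = solve-∀ 𝔹-ring

xor-cancelˡ : ∀ a b c → a xor b ≡ a xor c → b ≡ c
xor-cancelˡ false b c eq = eq
xor-cancelˡ true  b c eq = not-injective eq

xor≡false⇒≡ : ∀ a b → a xor b ≡ false → a ≡ b
xor≡false⇒≡ a b eq = sym (xor-cancelˡ a b a (trans eq (sym (xor-same a))))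

-- They are abstract, so that they never
-- unfold and rewriting with the lemmas below matches them syntactically; they
-- are analysed only through the views LtView, LeView and EqView.
abstract
  ltb leb eqb : ℕ → ℕ → Bool
  ltb m n = does (m <? n)
  leb m n = does (m ≤? n)
  eqb m n = does (m ≟ n)

data LtView (m n : ℕ) : Bool → Set where
  yes< : m < n → LtView m n true
  no<  : n ≤ m → LtView m n false

data LeView (m n : ℕ) : Bool → Set where
  yes≤ : m ≤ n → LeView m n true
  no≤  : n < m → LeView m n false

data EqView (m n : ℕ) : Bool → Set where
  yes= : m ≡ n → EqView m n true
  no=  : m ≢ n → EqView m n false

abstract
  ltv : ∀ m n → LtView m n (ltb m n)
  ltv m n = view (m <? n)
    where
    view : (d : Dec (m < n)) → LtView m n (does d)
    view (yes m<n) = yes< m<n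
    view (no  m≮n) = no< (≮⇒≥ m≮n)

  lev : ∀ m n → LeView m n (leb m n)
  lev m n = view (m ≤? n)
    where
    view : (d : Dec (m ≤ n)) → LeView m n (does d)
    view (yes m≤n) = yes≤ m≤n
    view (no  m≰n) = no≤ (≰⇒> m≰n)

  eqv : ∀ m n → EqView m n (eqb m n)
  eqv m n = view (m ≟ n)
    where
    view : (d : Dec (m ≡ n)) → EqView m n (does d)
    view (yes m≡n) = yes= m≡n
    view (no  m≢n) = no= m≢n

ltb-true : ∀ {m n} → m < n → ltb m n ≡ true
ltb-true {m} {n} m<n with ltb m n | ltv m n
... | _ | yes< _   = refl
... | _ | no<  n≤m = contradiction n≤m (<⇒≱ m<n)

ltb-false : ∀ {m n} → n ≤ m → ltb m n ≡ false
ltb-false {m} {n} n≤m with ltb m n | ltv m n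
... | _ | yes< m<n = contradiction n≤m (<⇒≱ m<n)
... | _ | no<  _   = refl

leb-true : ∀ {m n} → m ≤ n → leb m n ≡ true
leb-true {m} {n} m≤n with leb m n | lev m n
... | _ | yes≤ _   = refl
... | _ | no≤  n<m = contradiction m≤n (<⇒≱ n<m)

leb-false : ∀ {m n} → n < m → leb m n ≡ false
leb-false {m} {n} n<m with leb m n | lev m n
... | _ | yes≤ m≤n = contradiction m≤n (<⇒≱ n<m)
... | _ | no≤  _   = refl

eqb-true : ∀ {m n} → m ≡ n → eqb m n ≡ true
eqb-true {m} {n} m≡n with eqb m n | eqv m n
... | _ | yes= _   = refl
... | _ | no=  m≢n = contradiction m≡n m≢n

eqb-false : ∀ {m n} → m ≢ n → eqb m n ≡ false
eqb-false {m} {n} m≢n with eqb m n | eqv m n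
... | _ | yes= m≡n = contradiction m≡n m≢n
... | _ | no=  _   = refl

eqb-sym : ∀ m n → eqb m n ≡ eqb n m
eqb-sym m n with eqb m n | eqv m n
... | _ | yes= m≡n = sym (eqb-true (sym m≡n))
... | _ | no=  m≢n = sym (eqb-false (m≢n ∘ sym))

ltb-shift : ∀ Y y → y ≢ suc Y → ltb Y y ≡ ltb (suc Y) y
ltb-shift Y y y≢1+Y with ltb Y y | ltv Y y | ltb (suc Y) y | ltv (suc Y) y
... | _ | yes< _   | _ | yes< _   = refl
... | _ | yes< Y<y | _ | no<  y≤1+Y = contradiction (≤-antisym y≤1+Y Y<y) y≢1+Y
... | _ | no<  y≤Y | _ | yes< 1+Y<y = contradiction (≤-<-trans y≤Y (<-trans (n<1+n Y) 1+Y<y)) (<-irrefl refl)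
... | _ | no<  _   | _ | no<  _   = refl

ltb-flip : ∀ y q → (ltb y q xor ltb (suc y) q) ≡ eqb (suc y) q
ltb-flip y q with eqb (suc y) q | eqv (suc y) q
... | _ | yes= refl rewrite ltb-true (n<1+n y) | ltb-false (≤-refl {suc y}) = refl
... | _ | no=  ne   rewrite ltb-shift y q (ne ∘ sym) = xor-same (ltb (suc y) q)

leb-flipˡ : ∀ x X → (leb x X xor leb (suc x) X) ≡ eqb x X
leb-flipˡ x X with leb x X | lev x X | leb (suc x) X | lev (suc x) X
... | _ | yes≤ _   | _ | yes≤ x<X = sym (eqb-false (λ x≡X → <-irrefl x≡X x<X))
... | _ | yes≤ x≤X | _ | no≤ X<1+x = sym (eqb-true (≤-antisym x≤X (≤-pred X<1+x)))
... | _ | no≤  X<x | _ | yes≤ x<X = contradiction x<X (<-asym X<x)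
... | _ | no≤  X<x | _ | no≤  _   = sym (eqb-false (λ x≡X → <-irrefl (sym x≡X) X<x))

leb-flipʳ : ∀ p X → (leb p X xor leb p (suc X)) ≡ eqb p (suc X)
leb-flipʳ p X with leb p X | lev p X | leb p (suc X) | lev p (suc X)
... | _ | yes≤ p≤X | _ | yes≤ _   = sym (eqb-false (λ p≡1+X → 1+n≰n (subst (_≤ X) p≡1+X p≤X)))
... | _ | yes≤ p≤X | _ | no≤ 1+X<p = contradiction (m≤n⇒m≤1+n p≤X) (<⇒≱ 1+X<p)
... | _ | no≤  X<p | _ | yes≤ p≤1+X = sym (eqb-true (≤-antisym p≤1+X X<p))
... | _ | no≤  _   | _ | no≤ 1+X<p = sym (eqb-false (λ p≡1+X → <-irrefl (sym p≡1+X) 1+X<p))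

leb-shift : ∀ p x → p ≢ suc x → leb p (suc x) ≡ leb p x
leb-shift p x p≢1+x = sym (xor≡false⇒≡ _ _ (trans (leb-flipʳ p x) (eqb-false p≢1+x)))

leb-at-least : ∀ p a → a ≤ p → leb p a ≡ eqb p a
leb-at-least p a a≤p with leb p a | lev p a
... | _ | yes≤ p≤a = sym (eqb-true (≤-antisym p≤a a≤p))
... | _ | no≤  a<p = sym (eqb-false (λ p≡a → <-irrefl (sym p≡a) a<p))

data UnitStep : V → V → Set where
  right : ∀ x y → UnitStep (x , y) (suc x , y)
  left  : ∀ x y → UnitStep (suc x , y) (x , y)
  up    : ∀ x y → UnitStep (x , y) (x , suc y)
  down  : ∀ x y → UnitStep (x , suc y) (x , y)

∣m-n∣≡1 : ∀ m n → ∣ m - n ∣ ≡ 1 → n ≡ suc m ⊎ m ≡ suc n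
∣m-n∣≡1 zero    zero    ()
∣m-n∣≡1 zero    (suc n) eq = inj₁ eq
∣m-n∣≡1 (suc m) zero    eq = inj₂ eq
∣m-n∣≡1 (suc m) (suc n) eq with ∣m-n∣≡1 m n eq
... | inj₁ n≡1+m = inj₁ (cong suc n≡1+m)
... | inj₂ m≡1+n = inj₂ (cong suc m≡1+n)

m+n≡1 : ∀ m n → m + n ≡ 1 → (m ≡ 0 × n ≡ 1) ⊎ (m ≡ 1 × n ≡ 0)
m+n≡1 zero          n eq = inj₁ (refl , eq)
m+n≡1 (suc zero)    n eq = inj₂ (refl , suc-injective eq)
m+n≡1 (suc (suc m)) n ()

manhattan≡1⇒step : ∀ u v → Manhattan u v ≡ 1 → UnitStep u v
manhattan≡1⇒step (x , y) (x′ , y′) eq with m+n≡1 ∣ x - x′ ∣ ∣ y - y′ ∣ eq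
... | inj₁ (dx , dy) with ∣m-n∣≡0⇒m≡n {x} dx | ∣m-n∣≡1 y y′ dy
...   | refl | inj₁ refl = up x y
...   | refl | inj₂ refl = down x y′
manhattan≡1⇒step (x , y) (x′ , y′) eq | inj₂ (dx , dy) with ∣m-n∣≡1 x x′ dx | ∣m-n∣≡0⇒m≡n {y} dy
...   | inj₁ refl | refl = right x y
...   | inj₂ refl | refl = left x′ y

module PathVertices (R : V → V → Set) where

  Avoids : V → ∀ {A B} → Star R A B → Set
  Avoids z {A} ε = A ≢ z
  Avoids z (_◅_ {u} _ p) = u ≢ z × Avoids z p

  avoids-start : ∀ z {A B} (p : Star R A B) → Avoids z p → A ≢ z
  avoids-start z ε        A≢z      = A≢z
  avoids-start z (_ ◅ p) (A≢z , _) = A≢z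

  avoids-end : ∀ z {A B} (p : Star R A B) → Avoids z p → B ≢ z
  avoids-end z ε       B≢z        = B≢z
  avoids-end z (_ ◅ p) (_ , avoid) = avoids-end z p avoid

  avoids? : ∀ z {A B} (p : Star R A B) → Dec (Avoids z p)
  avoids? z {A} ε with ≡-dec _≟_ _≟_ A z
  ... | yes A≡z = no λ A≢z → A≢z A≡z
  ... | no  A≢z = yes A≢z
  avoids? z (_◅_ {u} _ p) with ≡-dec _≟_ _≟_ u z | avoids? z p
  ... | yes u≡z | _       = no λ avoid → proj₁ avoid u≡z
  ... | no  u≢z | yes avp = yes (u≢z , avp)
  ... | no  _   | no ¬avp = no λ avoid → ¬avp (proj₂ avoid)

  split-at : ∀ z {A B} (p : Star R A B) → ¬ Avoids z p → Star R A z × Star R z B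
  split-at z {A} ε ¬avoid with ≡-dec _≟_ _≟_ A z
  ... | yes refl = ε , ε
  ... | no  A≢z  = contradiction A≢z ¬avoid
  split-at z (_◅_ {u} e p) ¬avoid with ≡-dec _≟_ _≟_ u z
  ... | yes refl = ε , e ◅ p
  ... | no  u≢z with avoids? z p
  ...   | yes avp = contradiction (u≢z , avp) ¬avoid
  ...   | no ¬avp = let (p₁ , p₂) = split-at z p ¬avp in e ◅ p₁ , p₂

  Disjoint : ∀ {A B C D} → Star R A B → Star R C D → Set
  Disjoint {A} ε        P = Avoids A P
  Disjoint (_◅_ {u} _ q) P = Avoids u P × Disjoint q P

  disjoint-start : ∀ {A B C D} (q : Star R A B) (P : Star R C D) → Disjoint q P → Avoids A P
  disjoint-start ε       P avoid       = avoid
  disjoint-start (_ ◅ q) P (avoid , _) = avoid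

  disjoint-end : ∀ {A B C D} (q : Star R A B) (P : Star R C D) → Disjoint q P → Avoids B P
  disjoint-end ε       P avoid      = avoid
  disjoint-end (_ ◅ q) P (_ , disj) = disjoint-end q P disj

  disjoint? : ∀ {A B C D} (q : Star R A B) (P : Star R C D) → Dec (Disjoint q P)
  disjoint? {A} ε P = avoids? A P
  disjoint? (_◅_ {u} _ q) P with avoids? u P | disjoint? q P
  ... | yes avu | yes disj = yes (avu , disj)
  ... | no ¬avu | _        = no λ d → ¬avu (proj₁ d)
  ... | yes _   | no ¬disj = no λ d → ¬disj (proj₂ d)

  common-vertex : ∀ {A B C D} (q : Star R A B) (P : Star R C D) → ¬ Disjoint q P
                → ∃[ z ] (¬ Avoids z P × Star R A z × Star R z B)
  common-vertex {A} ε P ¬disj = A , ¬disj , ε , ε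
  common-vertex (_◅_ {u} e q) P ¬disj with avoids? u P
  ... | no ¬avu = u , ¬avu , ε , e ◅ q
  ... | yes avu with disjoint? q P
  ...   | yes disj = contradiction (avu , disj) ¬disj
  ...   | no ¬disj′ = let (z , z∈P , q₁ , q₂) = common-vertex q P ¬disj′ in z , z∈P , e ◅ q₁ , q₂

  splice : ∀ {u₁ v₁ u₂ v₂} (P : Star R u₁ v₁) (Q : Star R u₂ v₂) → ¬ Disjoint Q P → Star R u₁ v₂ × Star R u₂ v₁
  splice P Q ¬disjoint =
    let (z , z∈P , Q₁ , Q₂) = common-vertex Q P ¬disjoint
        (P₁ , P₂)           = split-at z P z∈P
    in P₁ ◅◅ Q₂ , Q₁ ◅◅ P₂

module Parity (R : V → V → Set) where
  open PathVertices R

  parity : (V → V → Bool) → ∀ {A B} → Star R A B → Bool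
  parity W ε = false
  parity W (_◅_ {u} {v} _ p) = W u v xor parity W p

  parity-telescopes : (f : V → Bool) → ∀ {A B} (p : Star R A B)
                    → parity (λ u v → f u xor f v) p ≡ f A xor f B
  parity-telescopes f ε = sym (xor-same (f _))
  parity-telescopes f (_◅_ {u} {v} _ p) rewrite parity-telescopes f p = xor-telescope (f u) (f v) (f _)

  parity-xor : (W W′ : V → V → Bool) → ∀ {A B} (p : Star R A B)
             → parity (λ u v → W u v xor W′ u v) p ≡ parity W p xor parity W′ p
  parity-xor W W′ ε = refl
  parity-xor W W′ (_◅_ {u} {v} _ p) rewrite parity-xor W W′ p =
    xor-interchange (W u v) (W′ u v) (parity W p) (parity W′ p)

  parity-cong : (W W′ : V → V → Bool) (z : V)
              → (∀ {u v} → R u v → u ≢ z → v ≢ z → W u v ≡ W′ u v)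
              → ∀ {A B} (p : Star R A B) → Avoids z p → parity W p ≡ parity W′ p
  parity-cong W W′ z agree ε _ = refl
  parity-cong W W′ z agree (e ◅ p) (u≢z , avoid) =
    cong₂ _xor_ (agree e u≢z (avoids-start z p avoid)) (parity-cong W W′ z agree p avoid)

  parity-vanishes : (W : V → V → Bool) → (∀ {u v} → R u v → W u v ≡ false)
                  → ∀ {A B} (p : Star R A B) → parity W p ≡ false
  parity-vanishes W vanish ε = refl
  parity-vanishes W vanish (e ◅ p) rewrite vanish e = parity-vanishes W vanish p

-- Edge weights.  crossing X Y u v: the edge uv is horizontal, crosses the
-- vertical line x = X + ½, and lies strictly above height Y.
crossing : ℕ → ℕ → V → V → Bool
crossing X Y (ux , uy) (vx , _) = ltb Y uy ∧ (leb ux X xor leb vx X)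

columnAbove : ℕ → ℕ → V → Bool
columnAbove X Y (wx , wy) = ltb Y wy ∧ eqb wx X

columnEntry : ℕ → ℕ → V → V → Bool
columnEntry X Y (ux , uy) (vx , vy) = ltb Y uy ∧ (eqb ux X xor eqb vx X)

crossing-shift-right : ∀ X Y u v → (crossing X Y u v xor crossing (suc X) Y u v) ≡ columnEntry (suc X) Y u v
crossing-shift-right X Y (ux , uy) (vx , vy) = begin
  (ltb Y uy ∧ (leb ux X xor leb vx X)) xor (ltb Y uy ∧ (leb ux (suc X) xor leb vx (suc X)))
    ≡⟨ ∧-distribˡ-xor (ltb Y uy) _ _ ⟨
  ltb Y uy ∧ ((leb ux X xor leb vx X) xor (leb ux (suc X) xor leb vx (suc X)))
    ≡⟨ cong (ltb Y uy ∧_) (xor-interchange (leb ux X) (leb vx X) (leb ux (suc X)) (leb vx (suc X))) ⟩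
  ltb Y uy ∧ ((leb ux X xor leb ux (suc X)) xor (leb vx X xor leb vx (suc X)))
    ≡⟨ cong (ltb Y uy ∧_) (cong₂ _xor_ (leb-flipʳ ux X) (leb-flipʳ vx X)) ⟩
  ltb Y uy ∧ (eqb ux (suc X) xor eqb vx (suc X))
    ∎
  where open ≡-Reasoning

columnEntry-telescopes : ∀ X Y {u v} → UnitStep u v → u ≢ (X , Y) → v ≢ (X , Y)
                       → columnEntry X Y u v ≡ columnAbove X Y u xor columnAbove X Y v
columnEntry-telescopes X Y (right x y) _ _ = ∧-distribˡ-xor (ltb Y y) (eqb x X) (eqb (suc x) X)
columnEntry-telescopes X Y (left x y)  _ _ = ∧-distribˡ-xor (ltb Y y) (eqb (suc x) X) (eqb x X)
columnEntry-telescopes X Y (up x y) u≢z _ with eqb x X | eqv x X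
... | _ | no= _ = ∧false≡xor∧false (ltb Y y) (ltb Y y) (ltb Y (suc y))
... | _ | yes= refl with ltb Y y | ltv Y y | ltb Y (suc y) | ltv Y (suc y)
...   | _ | yes< _   | _ | yes< _     = refl
...   | _ | yes< Y<y | _ | no< 1+y≤Y = contradiction (m<n⇒m<1+n Y<y) (≤⇒≯ 1+y≤Y)
...   | _ | no< y≤Y  | _ | yes< Y<1+y = contradiction (cong (x ,_) (≤-antisym y≤Y (≤-pred Y<1+y))) u≢z
...   | _ | no< _    | _ | no< _     = refl
columnEntry-telescopes X Y (down x y) _ v≢z with eqb x X | eqv x X
... | _ | no= _ = ∧false≡xor∧false (ltb Y (suc y)) (ltb Y (suc y)) (ltb Y y)
... | _ | yes= refl with ltb Y (suc y) | ltv Y (suc y) | ltb Y y | ltv Y y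
...   | _ | yes< _     | _ | yes< _   = refl
...   | _ | no< 1+y≤Y  | _ | yes< Y<y = contradiction (m<n⇒m<1+n Y<y) (≤⇒≯ 1+y≤Y)
...   | _ | yes< Y<1+y | _ | no< y≤Y  = contradiction (cong (x ,_) (≤-antisym y≤Y (≤-pred Y<1+y))) v≢z
...   | _ | no< _      | _ | no< _    = refl

crossing-shift-up : ∀ X Y {u v} → UnitStep u v → u ≢ (X , suc Y) → v ≢ (X , suc Y)
                  → crossing X Y u v ≡ crossing X (suc Y) u v
crossing-shift-up X Y (right x y) u≢z _ rewrite leb-flipˡ x X with eqb x X | eqv x X
... | _ | yes= refl = cong (_∧ true) (ltb-shift Y y (u≢z ∘ cong (x ,_)))
... | _ | no= _     = ∧false≡∧false _ _
crossing-shift-up X Y (left x y) _ v≢z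
  rewrite xor-comm (leb (suc x) X) (leb x X) | leb-flipˡ x X with eqb x X | eqv x X
... | _ | yes= refl = cong (_∧ true) (ltb-shift Y y (v≢z ∘ cong (x ,_)))
... | _ | no= _     = ∧false≡∧false _ _
crossing-shift-up X Y (up x y)   _ _ rewrite xor-same (leb x X) = ∧false≡∧false _ _
crossing-shift-up X Y (down x y) _ _ rewrite xor-same (leb x X) = ∧false≡∧false _ _

crossing-left-side : ∀ a Y u v → a ≤ proj₁ u → a ≤ proj₁ v → crossing a Y u v ≡ columnEntry a Y u v
crossing-left-side a Y (ux , uy) (vx , vy) a≤ux a≤vx rewrite leb-at-least ux a a≤ux | leb-at-least vx a a≤vx = refl

crossing-right-side : ∀ X Y u v → proj₁ u ≤ X → proj₁ v ≤ X → crossing X Y u v ≡ false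
crossing-right-side X Y (ux , uy) (vx , vy) ux≤X vx≤X rewrite leb-true ux≤X | leb-true vx≤X = ∧-zeroʳ _

crossing-above : ∀ X T u v → proj₂ u ≤ T → crossing X T u v ≡ false
crossing-above X T (ux , uy) v uy≤T rewrite ltb-false uy≤T = refl

crossing-bottom-row : ∀ X b {u v} → UnitStep u v → b ≤ proj₂ u → u ≢ (X , b) → v ≢ (X , b)
                    → crossing X b u v ≡ (leb (proj₁ u) X xor leb (proj₁ v) X)
crossing-bottom-row X b (right x y) b≤y u≢z _ rewrite leb-flipˡ x X with ltb b y | ltv b y
... | _ | yes< _ = refl
... | _ | no< y≤b with eqb x X | eqv x X
...   | _ | yes= refl = contradiction (cong (x ,_) (≤-antisym y≤b b≤y)) u≢z
...   | _ | no= _     = refl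
crossing-bottom-row X b (left x y) b≤y _ v≢z
  rewrite xor-comm (leb (suc x) X) (leb x X) | leb-flipˡ x X with ltb b y | ltv b y
... | _ | yes< _ = refl
... | _ | no< y≤b with eqb x X | eqv x X
...   | _ | yes= refl = contradiction (cong (x ,_) (≤-antisym y≤b b≤y)) v≢z
...   | _ | no= _     = refl
crossing-bottom-row X b (up x y)   _ _ _ rewrite xor-same (leb x X) = ∧-zeroʳ _
crossing-bottom-row X b (down x y) _ _ _ rewrite xor-same (leb x X) = ∧-zeroʳ _

module Square (a b t : ℕ) (t>0 : 0 < t) where
  at bt : ℕ
  at = a + t
  bt = b + t

  a<at : a < at
  a<at = subst (_≤ a + t) (+-comm a 1) (+-monoʳ-≤ a t>0)

  b<bt : b < bt
  b<bt = subst (_≤ b + t) (+-comm b 1) (+-monoʳ-≤ b t>0)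

  at≢a : at ≢ a
  at≢a at≡a = <-irrefl (sym at≡a) a<at

  bt≢b : bt ≢ b
  bt≢b bt≡b = <-irrefl (sym bt≡b) b<bt

  eqV : V → V → Bool
  eqV (x , y) (p , q) = eqb x p ∧ eqb y q

  eqV-false : ∀ z w → z ≢ w → eqV z w ≡ false
  eqV-false (x , y) (p , q) z≢w with eqb x p | eqv x p
  ... | _ | no= _     = refl
  ... | _ | yes= refl = eqb-false (z≢w ∘ cong (x ,_))

  eqV-refl : ∀ z → eqV z z ≡ true
  eqV-refl (x , y) rewrite eqb-true {x} refl | eqb-true {y} refl = refl

  -- outerArc w z: parity of crossings of the half-line going up from
  -- z + (½ , ½) with a fixed arc from the boundary vertex w to infinity outside
  -- the square: up and then to the left if w is on the top side, straight to the
  -- right if w is on the right side, and down or left (meeting no such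
  -- half-line) otherwise.
  outerArc : V → V → Bool
  outerArc (p , q) (x , y) = (eqb q bt ∧ ltb x p) xor ((eqb p at ∧ ltb q bt) ∧ (leb at x ∧ ltb y q))

  outerArc-shift-right : ∀ X Y p q → a ≤ X → suc X ≤ at → b ≤ Y → Y ≤ bt
                       → OnBoundary a b t (p , q) → (p , q) ≢ (suc X , Y)
                       → (outerArc (p , q) (X , Y) xor outerArc (p , q) (suc X , Y)) ≡ (ltb Y q ∧ eqb p (suc X))
  outerArc-shift-right X Y p q a≤X X<at b≤Y Y≤bt ((a≤p , p≤at , b≤q , q≤bt) , side) w≢z
    rewrite leb-false {at} {X} X<at with eqb p (suc X) | eqv p (suc X)
  ... | _ | no= p≢1+X rewrite ltb-shift X p p≢1+X with leb at (suc X) | lev at (suc X)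
  ...   | _ | no≤ _ = xor-self≡∧false ((eqb q bt ∧ ltb (suc X) p) xor ((eqb p at ∧ ltb q bt) ∧ false)) (ltb Y q)
  ...   | _ | yes≤ at≤1+X with eqb p at | eqv p at
  ...     | _ | yes= p≡at = contradiction (trans p≡at (≤-antisym at≤1+X X<at)) p≢1+X
  ...     | _ | no= _     = xor-self≡∧false ((eqb q bt ∧ ltb (suc X) p) xor false) (ltb Y q)
  outerArc-shift-right X Y p q a≤X X<at b≤Y Y≤bt ((a≤p , p≤at , b≤q , q≤bt) , side) w≢z | _ | yes= refl
    rewrite ltb-true (n<1+n X) | ltb-false (≤-refl {suc X}) with eqb q bt | eqv q bt
  ... | _ | yes= refl rewrite ltb-false (≤-refl {bt}) with ltb Y bt | ltv Y bt
  ...   | _ | yes< _    rewrite ∧-zeroʳ (eqb (suc X) at) = refl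
  ...   | _ | no< bt≤Y = contradiction (cong (suc X ,_) (≤-antisym bt≤Y Y≤bt)) w≢z
  outerArc-shift-right X Y p q a≤X X<at b≤Y Y≤bt ((a≤p , p≤at , b≤q , q≤bt) , side) w≢z | _ | yes= refl | _ | no= q≢bt
    rewrite ltb-true (≤∧≢⇒< q≤bt q≢bt) with eqb (suc X) at | eqv (suc X) at
  ... | _ | yes= 1+X≡at rewrite leb-true (≤-reflexive (sym 1+X≡at)) = sym (∧-identityʳ _)
  ... | _ | no= 1+X≢at with side
  ...   | inj₁ p≡a                = contradiction (subst (_≤ X) (sym p≡a) a≤X) 1+n≰n
  ...   | inj₂ (inj₁ p≡at)        = contradiction p≡at 1+X≢at
  ...   | inj₂ (inj₂ (inj₁ refl)) rewrite ltb-false b≤Y = refl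
  ...   | inj₂ (inj₂ (inj₂ q≡bt)) = contradiction q≡bt q≢bt

  outerArc-shift-up : ∀ X Y p q → X ≤ at → (p , q) ≢ (X , suc Y)
                    → outerArc (p , q) (X , Y) ≡ outerArc (p , q) (X , suc Y)
  outerArc-shift-up X Y p q X≤at w≢z with leb at X | lev at X
  ... | _ | no≤ _ = refl
  ... | _ | yes≤ at≤X with eqb p at | eqv p at
  ...   | _ | no= _     = refl
  ...   | _ | yes= p≡at rewrite ltb-shift Y q (λ q≡1+Y → w≢z (cong₂ _,_ (trans p≡at (≤-antisym at≤X X≤at)) q≡1+Y)) = refl

  -- endCrossing z w: contribution of the path end w to the crossing parity at
  -- a boundary vertex z off the path.
  endCrossing : V → V → Bool
  endCrossing (x , y) (p , q) = ((eqb y b ∧ ltb x at) ∧ leb p x) xor ((eqb x a ∧ ltb b y) ∧ (eqb p a ∧ ltb y q))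

  endCrossing-right : ∀ Y p q → endCrossing (at , Y) (p , q) ≡ false
  endCrossing-right Y p q rewrite ltb-false (≤-refl {at}) | eqb-false at≢a | ∧-zeroʳ (eqb Y b) = refl

  endCrossing-top : ∀ X p q → q ≤ bt → endCrossing (X , bt) (p , q) ≡ false
  endCrossing-top X p q q≤bt
    rewrite eqb-false bt≢b | ltb-false q≤bt | ∧-zeroʳ (eqb p a) | ∧-zeroʳ (eqb X a ∧ ltb b bt) = refl

  endCrossing-bottom : ∀ X p q → X < at → endCrossing (X , b) (p , q) ≡ leb p X
  endCrossing-bottom X p q X<at
    rewrite eqb-true {b} refl | ltb-true X<at | ltb-false (≤-refl {b}) | ∧-zeroʳ (eqb X a) = xor-identityʳ _

  endCrossing-left : ∀ Y p q → b < Y → endCrossing (a , Y) (p , q) ≡ (ltb Y q ∧ eqb p a)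
  endCrossing-left Y p q b<Y
    rewrite eqb-false {Y} {b} (λ Y≡b → <-irrefl (sym Y≡b) b<Y) | eqb-true {a} refl | ltb-true b<Y = ∧-comm (eqb p a) (ltb Y q)

  upperLeft : V → Bool
  upperLeft (x , y) = eqb y bt ∨ (eqb x a ∧ ltb b y)

  -- boundaryParity z w: the winding parity at a boundary vertex z contributed by
  -- a path end at w.  The last summand only matters for z = w; it is chosen so
  -- that the jump law ParityJump below has a uniform form.
  boundaryParity : V → V → Bool
  boundaryParity z w = (endCrossing z w xor outerArc w z) xor (eqV z w ∧ upperLeft z)

  boundaryParity-bottom : ∀ x p q → x < at → boundaryParity (x , b) (p , q) ≡ (leb p x xor (eqb q bt ∧ ltb x p))
  boundaryParity-bottom x p q x<at
    rewrite endCrossing-bottom x p q x<at | eqb-false (bt≢b ∘ sym) | ltb-false (≤-refl {b}) | ∧-zeroʳ (eqb x a)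
          | ∧-zeroʳ (eqV (x , b) (p , q)) | leb-false x<at | ∧-zeroʳ (eqb p at ∧ ltb q bt)
          | xor-identityʳ (eqb q bt ∧ ltb x p) = xor-identityʳ _

  boundaryParity-right : ∀ y p q → y < bt → p ≤ at → boundaryParity (at , y) (p , q) ≡ ((eqb p at ∧ ltb q bt) ∧ ltb y q)
  boundaryParity-right y p q y<bt p≤at
    rewrite endCrossing-right y p q | eqb-false {y} {bt} (λ y≡bt → <-irrefl y≡bt y<bt) | eqb-false at≢a
          | ∧-zeroʳ (eqV (at , y) (p , q)) | ltb-false p≤at | leb-true (≤-refl {at}) | ∧-zeroʳ (eqb q bt) = xor-identityʳ _

  boundaryParity-top : ∀ x p q → q ≤ bt → boundaryParity (x , bt) (p , q) ≡ ((eqb q bt ∧ ltb x p) xor (eqb x p ∧ eqb bt q))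
  boundaryParity-top x p q q≤bt
    rewrite endCrossing-top x p q q≤bt | eqb-true {bt} refl | ∧-identityʳ (eqV (x , bt) (p , q)) | ltb-false q≤bt
          | ∧-zeroʳ (leb at x) | ∧-zeroʳ (eqb p at ∧ ltb q bt) | xor-identityʳ (eqb q bt ∧ ltb x p) = refl

  boundaryParity-left : ∀ y p q → b < y
                      → boundaryParity (a , y) (p , q) ≡ (((ltb y q ∧ eqb p a) xor (eqb q bt ∧ ltb a p)) xor (eqb a p ∧ eqb y q))
  boundaryParity-left y p q b<y
    rewrite endCrossing-left y p q b<y | eqb-true {a} refl | ltb-true b<y | ∨-zeroʳ (eqb y bt)
          | ∧-identityʳ (eqV (a , y) (p , q)) | leb-false a<at | ∧-zeroʳ (eqb p at ∧ ltb q bt)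
          | xor-identityʳ (eqb q bt ∧ ltb a p) = refl

  ParityJump : V → V → V → Set
  ParityJump z z′ w = ((boundaryParity z′ w xor boundaryParity z w) xor eqV z′ w) ≡ eqV z′ (at , b)

  jump-bottom : ∀ x p q → a ≤ x → x < at → OnBoundary a b t (p , q) → ParityJump (x , b) (suc x , b) (p , q)
  jump-bottom x p q a≤x x<at ((a≤p , p≤at , b≤q , q≤bt) , side) with suc x <? at
  ... | yes 1+x<at
    rewrite boundaryParity-bottom (suc x) p q 1+x<at | boundaryParity-bottom x p q x<at
          | eqb-false {suc x} {at} (λ 1+x≡at → <-irrefl 1+x≡at 1+x<at) | eqb-sym (suc x) p
    with eqb p (suc x) | eqv p (suc x)
  ...   | _ | no= p≢1+x rewrite leb-shift p x p≢1+x | sym (ltb-shift x p p≢1+x) =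
    cong (_xor false) (xor-same (leb p x xor (eqb q bt ∧ ltb x p)))
  ...   | _ | yes= refl
    rewrite leb-true (≤-refl {suc x}) | leb-false (n<1+n x) | ltb-false (≤-refl {suc x}) | ltb-true (n<1+n x)
    with eqb q bt | eqv q bt
  ...     | _ | yes= refl rewrite eqb-false (bt≢b ∘ sym) = refl
  ...     | _ | no= q≢bt with side
  ...       | inj₁ 1+x≡a                = contradiction (subst (_≤ x) (sym 1+x≡a) a≤x) 1+n≰n
  ...       | inj₂ (inj₁ 1+x≡at)        = contradiction 1+x<at (<-irrefl 1+x≡at)
  ...       | inj₂ (inj₂ (inj₁ refl))   rewrite eqb-true {b} refl = refl
  ...       | inj₂ (inj₂ (inj₂ q≡bt))   = contradiction q≡bt q≢bt
  jump-bottom x p q a≤x x<at ((a≤p , p≤at , b≤q , q≤bt) , side) | no 1+x≮at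
    with ≤-antisym x<at (≮⇒≥ 1+x≮at)
  ... | 1+x≡at
    rewrite boundaryParity-bottom x p q x<at | 1+x≡at | boundaryParity-right b p q b<bt p≤at | eqV-refl (at , b)
          | eqb-sym at p
    with eqb p at | eqv p at
  ...   | _ | yes= refl rewrite leb-false (≤-reflexive 1+x≡at) | ltb-true (≤-reflexive 1+x≡at) with eqb q bt | eqv q bt
  ...     | _ | yes= refl rewrite ltb-false (≤-refl {bt}) | eqb-false (bt≢b ∘ sym) = refl
  ...     | _ | no= q≢bt rewrite ltb-true (≤∧≢⇒< q≤bt q≢bt) with ltb b q | ltv b q
  ...       | _ | yes< b<q rewrite eqb-false {b} {q} (λ b≡q → <-irrefl b≡q b<q) = refl
  ...       | _ | no< q≤b  rewrite eqb-true {b} {q} (≤-antisym b≤q q≤b) = refl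
  jump-bottom x p q a≤x x<at ((a≤p , p≤at , b≤q , q≤bt) , side) | no 1+x≮at | 1+x≡at | _ | no= p≢at
    rewrite leb-true (≤-pred (subst (suc p ≤_) (sym 1+x≡at) (≤∧≢⇒< p≤at p≢at)))
          | ltb-false (≤-pred (subst (suc p ≤_) (sym 1+x≡at) (≤∧≢⇒< p≤at p≢at)))
          | ∧-zeroʳ (eqb q bt) = refl

  below-top-corner : ∀ y p q → suc y ≡ bt → ((eqb p at ∧ ltb q bt) ∧ ltb y q) ≡ false
  below-top-corner y p q 1+y≡bt with ltb y q | ltv y q
  ... | _ | no< _   = ∧-zeroʳ _
  ... | _ | yes< y<q rewrite ltb-false (subst (_≤ q) 1+y≡bt y<q) | ∧-zeroʳ (eqb p at) = refl

  jump-right : ∀ y p q → b ≤ y → y < bt → OnBoundary a b t (p , q) → ParityJump (at , y) (at , suc y) (p , q)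
  jump-right y p q b≤y y<bt ((a≤p , p≤at , b≤q , q≤bt) , side) with suc y <? bt
  ... | yes 1+y<bt
    rewrite boundaryParity-right (suc y) p q 1+y<bt p≤at | boundaryParity-right y p q y<bt p≤at | eqb-true {at} refl
          | eqb-false {suc y} {b} (λ 1+y≡b → 1+n≰n (subst (_≤ y) (sym 1+y≡b) b≤y)) | eqb-sym at p
    with eqb p at | eqv p at
  ...   | _ | no= _ = refl
  ...   | _ | yes= refl with eqb (suc y) q | eqv (suc y) q
  ...     | _ | yes= refl rewrite ltb-true 1+y<bt | ltb-false (≤-refl {suc y}) | ltb-true (n<1+n y) = refl
  ...     | _ | no= 1+y≢q rewrite sym (ltb-shift y q (1+y≢q ∘ sym)) = cong (_xor false) (xor-same (ltb q bt ∧ ltb y q))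
  jump-right y p q b≤y y<bt ((a≤p , p≤at , b≤q , q≤bt) , side) | no 1+y≮bt with ≤-antisym y<bt (≮⇒≥ 1+y≮bt)
  ... | 1+y≡bt
    rewrite boundaryParity-right y p q y<bt p≤at | below-top-corner y p q 1+y≡bt | 1+y≡bt | boundaryParity-top at p q q≤bt
          | ltb-false p≤at | eqb-true {at} refl | eqb-false bt≢b | ∧-zeroʳ (eqb q bt) = arith (eqb at p ∧ eqb bt q)
    where
    arith : ∀ e → ((false xor e) xor false) xor e ≡ false
    arith = solve-∀ 𝔹-ring

  jump-top : ∀ x p q → a ≤ x → x < at → OnBoundary a b t (p , q) → ParityJump (suc x , bt) (x , bt) (p , q)
  jump-top x p q a≤x x<at ((a≤p , p≤at , b≤q , q≤bt) , side)
    rewrite boundaryParity-top x p q q≤bt | boundaryParity-top (suc x) p q q≤bt | eqb-false bt≢b | ∧-zeroʳ (eqb x at)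
          | eqb-sym (suc x) p
    with eqb p (suc x) | eqv p (suc x)
  ... | _ | no= p≢1+x rewrite sym (ltb-shift x p p≢1+x) = arith (eqb q bt ∧ ltb x p) (eqb x p ∧ eqb bt q)
    where
    arith : ∀ l e → ((l xor e) xor (l xor false)) xor e ≡ false
    arith = solve-∀ 𝔹-ring
  ... | _ | yes= refl
    rewrite ltb-true (n<1+n x) | ltb-false (≤-refl {suc x}) | eqb-false {x} {suc x} (λ x≡1+x → <-irrefl x≡1+x (n<1+n x))
    with eqb q bt | eqv q bt
  ...   | _ | yes= refl rewrite eqb-true {bt} refl = refl
  ...   | _ | no= q≢bt  rewrite eqb-false (q≢bt ∘ sym) = refl

  jump-left : ∀ y p q → b ≤ y → y < bt → OnBoundary a b t (p , q) → ParityJump (a , suc y) (a , y) (p , q)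
  jump-left y p q b≤y y<bt ((a≤p , p≤at , b≤q , q≤bt) , side) with b <? y
  ... | yes b<y
    rewrite boundaryParity-left y p q b<y | boundaryParity-left (suc y) p q (m<n⇒m<1+n b<y) | eqb-false (at≢a ∘ sym)
          | eqb-sym a p
    with eqb p a | eqv p a
  ...   | _ | no= _ = arith (ltb y q) (ltb (suc y) q) (eqb q bt ∧ ltb a p)
    where
    arith : ∀ l l′ c → ((((l ∧ false) xor c) xor false) xor (((l′ ∧ false) xor c) xor false)) xor false ≡ false
    arith = solve-∀ 𝔹-ring
  ...   | _ | yes= refl rewrite ltb-false (≤-refl {a}) | sym (ltb-flip y q) =
    arith (ltb y q) (ltb (suc y) q) (eqb y q) (eqb q bt ∧ false)
    where
    arith : ∀ l l′ e c → ((((l ∧ true) xor c) xor e) xor (((l′ ∧ true) xor c) xor (l xor l′))) xor e ≡ false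
    arith = solve-∀ 𝔹-ring
  jump-left y p q b≤y y<bt ((a≤p , p≤at , b≤q , q≤bt) , side) | no b≮y with ≤-antisym (≮⇒≥ b≮y) b≤y
  ... | refl
    rewrite boundaryParity-bottom a p q a<at | boundaryParity-left (suc b) p q ≤-refl | leb-at-least p a a≤p
          | eqb-false (at≢a ∘ sym) | eqb-sym a p
    with eqb p a | eqv p a
  ...   | _ | no= _ = arith (ltb (suc b) q) (eqb q bt ∧ ltb a p)
    where
    arith : ∀ l c → ((false xor c) xor (((l ∧ false) xor c) xor false)) xor false ≡ false
    arith = solve-∀ 𝔹-ring
  ...   | _ | yes= refl rewrite ltb-false (≤-refl {a}) | ∧-zeroʳ (eqb q bt) | ∧-identityʳ (ltb (suc b) q)
    with eqb b q | eqv b q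
  ...     | _ | yes= refl rewrite ltb-false (n≤1+n b) | eqb-false {suc b} {b} (λ 1+b≡b → <-irrefl (sym 1+b≡b) (n<1+n b)) = refl
  ...     | _ | no= b≢q with eqb (suc b) q | eqv (suc b) q
  ...       | _ | yes= refl rewrite ltb-false (≤-refl {suc b}) = refl
  ...       | _ | no= 1+b≢q rewrite ltb-true (≤∧≢⇒< (≤∧≢⇒< b≤q b≢q) 1+b≢q) = refl

  boundaryParity-jump : ∀ {z z′} → Next a b t z z′ → ∀ w → OnBoundary a b t w → ParityJump z z′ w
  boundaryParity-jump (bot x a≤x x<at) (p , q) = jump-bottom x p q a≤x x<at
  boundaryParity-jump (rgt y b≤y y<bt) (p , q) = jump-right y p q b≤y y<bt
  boundaryParity-jump (top x a≤x x<at) (p , q) = jump-top x p q a≤x x<at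
  boundaryParity-jump (lft y b≤y y<bt) (p , q) = jump-left y p q b≤y y<bt

  -- The counter-clockwise successor as a function; Next is its graph on the
  -- boundary, so Next and its iterates Pow are functional.
  successor : V → V
  successor (x , y) =
    if eqb y b ∧ ltb x at then (suc x , y) else
    if eqb x at ∧ ltb y bt then (x , suc y) else
    if eqb y bt ∧ ltb a x then (pred x , y) else (x , pred y)

  next⇒successor : ∀ {z z′} → Next a b t z z′ → z′ ≡ successor z
  next⇒successor (bot x a≤x x<at) rewrite eqb-true {b} refl | ltb-true x<at = refl
  next⇒successor (rgt y b≤y y<bt)
    rewrite ltb-false (≤-refl {at}) | ∧-zeroʳ (eqb y b) | eqb-true {at} refl | ltb-true y<bt = refl
  next⇒successor (top x a≤x x<at)
    rewrite eqb-false bt≢b | ltb-false (≤-refl {bt}) | ∧-zeroʳ (eqb (suc x) at) | eqb-true {bt} refl | ltb-true (s≤s a≤x) = refl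
  next⇒successor (lft y b≤y y<bt)
    rewrite eqb-false {suc y} {b} (λ 1+y≡b → 1+n≰n (subst (_≤ y) (sym 1+y≡b) b≤y)) | eqb-false (at≢a ∘ sym)
          | ltb-false (≤-refl {a}) | ∧-zeroʳ (eqb (suc y) bt) = refl

  next-functional : ∀ {z z₁ z₂} → Next a b t z z₁ → Next a b t z z₂ → z₁ ≡ z₂
  next-functional n₁ n₂ = trans (next⇒successor n₁) (sym (next⇒successor n₂))

  pow-functional : ∀ {n u w w′} → Pow a b t n u w → Pow a b t n u w′ → w ≡ w′
  pow-functional here here = refl
  pow-functional (there n₁ p₁) (there n₂ p₂) with next-functional n₁ n₂
  ... | refl = pow-functional p₁ p₂

  pow-+ : ∀ {m n u v w} → Pow a b t m u v → Pow a b t n v w → Pow a b t (m + n) u w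
  pow-+ here         q = q
  pow-+ (there nx p) q = there nx (pow-+ p q)

  pow-split : ∀ m n {u w} → Pow a b t (m + n) u w → ∃[ v ] (Pow a b t m u v × Pow a b t n v w)
  pow-split zero    n p            = _ , here , p
  pow-split (suc m) n (there nx p) = let (v , p₁ , p₂) = pow-split m n p in v , there nx p₁ , p₂

  pow-last : ∀ n {u w} → Pow a b t (suc n) u w → ∃[ v ] (Pow a b t n u v × Next a b t v w)
  pow-last zero    (there nx here) = _ , here , nx
  pow-last (suc n) (there nx p)    = let (v , p₁ , nv) = pow-last n p in v , there nx p₁ , nv

module BoundaryWalk (a b t : ℕ) (t>0 : 0 < t) (u₁ v₁ : V)
                    (u₁∈∂ : OnBoundary a b t u₁) (v₁∈∂ : OnBoundary a b t v₁) where
  open Square a b t t>0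

  Ψ : V → Bool
  Ψ z = boundaryParity z u₁ xor boundaryParity z v₁

  -- Ψ flips exactly when the walk arrives at u₁ or at v₁ (the corner flips cancel).
  Ψ-next : ∀ {z z′} → Next a b t z z′ → Ψ z′ ≡ ((Ψ z xor eqV z′ u₁) xor eqV z′ v₁)
  Ψ-next {z} {z′} nz = xor≡false⇒≡ _ _ (begin
    Ψ z′ xor ((Ψ z xor eqV z′ u₁) xor eqV z′ v₁)
      ≡⟨ regroup (boundaryParity z′ u₁) (boundaryParity z′ v₁) (boundaryParity z u₁) (boundaryParity z v₁) (eqV z′ u₁) (eqV z′ v₁) ⟩
    (((boundaryParity z′ u₁ xor boundaryParity z u₁) xor eqV z′ u₁) xor ((boundaryParity z′ v₁ xor boundaryParity z v₁) xor eqV z′ v₁))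
      ≡⟨ cong₂ _xor_ (boundaryParity-jump nz u₁ u₁∈∂) (boundaryParity-jump nz v₁ v₁∈∂) ⟩
    eqV z′ (at , b) xor eqV z′ (at , b)
      ≡⟨ xor-same (eqV z′ (at , b)) ⟩
    false ∎)
    where
    open ≡-Reasoning
    regroup : ∀ A B C D E F → (A xor B) xor (((C xor D) xor E) xor F) ≡ ((A xor C) xor E) xor ((B xor D) xor F)
    regroup = solve-∀ 𝔹-ring

  -- Let v₁ = c^p(u₁) and y = c^m(u₁) with minimal exponents p ≥ 1 and m.  Within
  -- the first m steps the walk from u₁ never returns to u₁ and meets v₁ exactly
  -- at step p, so Ψ(c^n(u₁)) = Ψ(u₁) ⊕ [p ≤ n] for n ≤ m.
  module FromU₁ (p : ℕ) (p≥1 : 1 ≤ p) (exp-v₁ : Exp a b t u₁ v₁ p)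
                (m : ℕ) (y : V) (exp-y : Exp a b t u₁ y m) where

    prefix : ∀ n → n ≤ m → ∃[ v ] (Pow a b t n u₁ v × Pow a b t (m ∸ n) v y)
    prefix n n≤m = pow-split n (m ∸ n) (subst (λ k → Pow a b t k u₁ y) (sym (m+[n∸m]≡n n≤m)) (proj₁ exp-y))

    -- Returning to u₁ after k + 1 ≤ m steps would give a shorter walk to y.
    no-return : ∀ k → suc k ≤ m → ∀ {x} → Pow a b t (suc k) u₁ x → x ≢ u₁
    no-return k k<m walk refl with prefix (suc k) k<m
    ... | v , walk′ , rest with pow-functional walk′ walk
    ... | refl = proj₂ exp-y (m ∸ suc k) (∸-monoʳ-< {m} {suc k} {0} z<s k<m) rest

    meets-v₁ : ∀ k → suc k ≤ m → ∀ {x} → Pow a b t (suc k) u₁ x → eqV x v₁ ≡ eqb p (suc k)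
    meets-v₁ k k<m {x} walk with eqb p (suc k) | eqv p (suc k)
    ... | _ | yes= refl rewrite pow-functional walk (proj₁ exp-v₁) = eqV-refl v₁
    ... | _ | no= p≢1+k = eqV-false x v₁ (λ x≡v₁ → not-at-v₁ (subst (Pow a b t (suc k) u₁) x≡v₁ walk))
      where
      not-at-v₁ : ¬ Pow a b t (suc k) u₁ v₁
      not-at-v₁ walk with p ≤? suc k
      ... | no p≰1+k = proj₂ exp-v₁ (suc k) (≰⇒> p≰1+k) walk
      ... | yes p≤1+k with prefix (suc k) k<m
      ...   | v , walk′ , rest with pow-functional walk′ walk
      ...     | refl = proj₂ exp-y (p + (m ∸ suc k)) shorter (pow-+ (proj₁ exp-v₁) rest)
        where
        shorter : p + (m ∸ suc k) < m
        shorter = subst (p + (m ∸ suc k) <_) (m+[n∸m]≡n k<m) (+-monoˡ-< (m ∸ suc k) (≤∧≢⇒< p≤1+k p≢1+k))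

    walk-parity : ∀ n → n ≤ m → ∀ {x} → Pow a b t n u₁ x → Ψ x ≡ (Ψ u₁ xor leb p n)
    walk-parity zero _ here rewrite leb-false {p} {0} p≥1 = sym (xor-identityʳ _)
    walk-parity (suc k) k<m {x} walk with pow-last k walk
    ... | x′ , walk′ , nx′ = begin
      Ψ x
        ≡⟨ Ψ-next nx′ ⟩
      (Ψ x′ xor eqV x u₁) xor eqV x v₁
        ≡⟨ cong₂ (λ A B → (A xor B) xor eqV x v₁) (walk-parity k (<⇒≤ k<m) walk′) (eqV-false x u₁ (no-return k k<m walk)) ⟩
      ((Ψ u₁ xor leb p k) xor false) xor eqV x v₁
        ≡⟨ cong (((Ψ u₁ xor leb p k) xor false) xor_) (meets-v₁ k k<m walk) ⟩
      ((Ψ u₁ xor leb p k) xor false) xor eqb p (suc k)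
        ≡⟨ regroup (Ψ u₁) (leb p k) (eqb p (suc k)) ⟩
      Ψ u₁ xor (leb p k xor eqb p (suc k))
        ≡⟨ cong (Ψ u₁ xor_) (trans (cong (leb p k xor_) (sym (leb-flipʳ p k))) (cancel (leb p k) (leb p (suc k)))) ⟩
      Ψ u₁ xor leb p (suc k) ∎
      where
      open ≡-Reasoning
      regroup : ∀ A B C → ((A xor B) xor false) xor C ≡ A xor (B xor C)
      regroup = solve-∀ 𝔹-ring
      cancel : ∀ l l′ → l xor (l xor l′) ≡ l′
      cancel = solve-∀ 𝔹-ring

module Winding (a b t : ℕ) (t>0 : 0 < t) (R : V → V → Set)
               (R⇒step : ∀ {u v} → R u v → UnitStep u v)
               (R⇒inside : ∀ {u v} → R u v → InSquare a b t u × InSquare a b t v)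
               (u₁ v₁ : V) (P : Star R u₁ v₁)
               (u₁∈∂ : OnBoundary a b t u₁) (v₁∈∂ : OnBoundary a b t v₁) where
  open Square a b t t>0
  open PathVertices R
  open Parity R

  φ : ℕ → ℕ → Bool
  φ X Y = parity (crossing X Y) P

  ψ : V → Bool
  ψ (X , Y) = φ X Y xor (outerArc u₁ (X , Y) xor outerArc v₁ (X , Y))

  ψ-shift-right : ∀ X Y → InSquare a b t (X , Y) → InSquare a b t (suc X , Y) → Avoids (suc X , Y) P
                → ψ (X , Y) ≡ ψ (suc X , Y)
  ψ-shift-right X Y (a≤X , _ , b≤Y , Y≤bt) (_ , X<at , _ , _) avoid =
    xor≡false⇒≡ _ _ (begin
      ψ (X , Y) xor ψ (suc X , Y)
        ≡⟨ xor-interchange (φ X Y) _ (φ (suc X) Y) _ ⟩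
      (φ X Y xor φ (suc X) Y) xor ((outerArc u₁ (X , Y) xor outerArc v₁ (X , Y)) xor (outerArc u₁ (suc X , Y) xor outerArc v₁ (suc X , Y)))
        ≡⟨ cong₂ _xor_ φ-change arc-change ⟩
      endpointsOnColumn xor endpointsOnColumn
        ≡⟨ xor-same endpointsOnColumn ⟩
      false ∎)
    where
    open ≡-Reasoning
    endpointsOnColumn : Bool
    endpointsOnColumn = columnAbove (suc X) Y u₁ xor columnAbove (suc X) Y v₁

    φ-change : (φ X Y xor φ (suc X) Y) ≡ endpointsOnColumn
    φ-change = begin
      φ X Y xor φ (suc X) Y
        ≡⟨ parity-xor (crossing X Y) (crossing (suc X) Y) P ⟨
      parity (λ u v → crossing X Y u v xor crossing (suc X) Y u v) P
        ≡⟨ parity-cong _ _ (suc X , Y) (λ {u} {v} _ _ _ → crossing-shift-right X Y u v) P avoid ⟩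
      parity (columnEntry (suc X) Y) P
        ≡⟨ parity-cong _ _ (suc X , Y) (λ e → columnEntry-telescopes (suc X) Y (R⇒step e)) P avoid ⟩
      parity (λ u v → columnAbove (suc X) Y u xor columnAbove (suc X) Y v) P
        ≡⟨ parity-telescopes (columnAbove (suc X) Y) P ⟩
      endpointsOnColumn ∎

    arc-change₁ : ∀ w → OnBoundary a b t w → w ≢ (suc X , Y)
                → (outerArc w (X , Y) xor outerArc w (suc X , Y)) ≡ columnAbove (suc X) Y w
    arc-change₁ (p , q) w∈∂ w≢z = outerArc-shift-right X Y p q a≤X X<at b≤Y Y≤bt w∈∂ w≢z

    arc-change : ((outerArc u₁ (X , Y) xor outerArc v₁ (X , Y)) xor (outerArc u₁ (suc X , Y) xor outerArc v₁ (suc X , Y)))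
               ≡ endpointsOnColumn
    arc-change = trans (xor-interchange (outerArc u₁ (X , Y)) _ _ _)
                       (cong₂ _xor_ (arc-change₁ u₁ u₁∈∂ (avoids-start _ P avoid)) (arc-change₁ v₁ v₁∈∂ (avoids-end _ P avoid)))

  ψ-shift-up : ∀ X Y → InSquare a b t (X , Y) → Avoids (X , suc Y) P → ψ (X , Y) ≡ ψ (X , suc Y)
  ψ-shift-up X Y (_ , X≤at , _ , _) avoid =
    cong₂ _xor_ (parity-cong _ _ (X , suc Y) (λ e → crossing-shift-up X Y (R⇒step e)) P avoid)
                (cong₂ _xor_ (arc-unchanged u₁ (avoids-start _ P avoid)) (arc-unchanged v₁ (avoids-end _ P avoid)))
    where
    arc-unchanged : ∀ w → w ≢ (X , suc Y) → outerArc w (X , Y) ≡ outerArc w (X , suc Y)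
    arc-unchanged (p , q) w≢z = outerArc-shift-up X Y p q X≤at w≢z

  ψ-step : ∀ {z z′} → R z z′ → Avoids z P → Avoids z′ P → ψ z ≡ ψ z′
  ψ-step e avz avz′ with R⇒step e | R⇒inside e
  ... | right x y | z∈□ , z′∈□ = ψ-shift-right x y z∈□ z′∈□ avz′
  ... | left x y  | z∈□ , z′∈□ = sym (ψ-shift-right x y z′∈□ z∈□ avz)
  ... | up x y    | z∈□ , _    = ψ-shift-up x y z∈□ avz′
  ... | down x y  | _ , z′∈□   = sym (ψ-shift-up x y z′∈□ avz)

  ψ-path : ∀ {A B} (q : Star R A B) → Disjoint q P → ψ A ≡ ψ B
  ψ-path ε _ = refl
  ψ-path (e ◅ q) (avz , disj) = trans (ψ-step e avz (disjoint-start q P disj)) (ψ-path q disj)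

  φ-right : ∀ Y → φ at Y ≡ false
  φ-right Y = parity-vanishes (crossing at Y) (λ {u} {v} e → crossing-right-side at Y u v (x≤at (proj₁ (R⇒inside e))) (x≤at (proj₂ (R⇒inside e)))) P
    where
    x≤at : ∀ {w} → InSquare a b t w → proj₁ w ≤ at
    x≤at (_ , x≤at , _ , _) = x≤at

  φ-top : ∀ X → φ X bt ≡ false
  φ-top X = parity-vanishes (crossing X bt) (λ {u} {v} e → crossing-above X bt u v (y≤bt (proj₁ (R⇒inside e)))) P
    where
    y≤bt : ∀ {w} → InSquare a b t w → proj₂ w ≤ bt
    y≤bt (_ , _ , _ , y≤bt) = y≤bt

  φ-bottom : ∀ X → Avoids (X , b) P → φ X b ≡ (leb (proj₁ u₁) X xor leb (proj₁ v₁) X)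
  φ-bottom X avoid = trans
    (parity-cong _ (λ u v → leb (proj₁ u) X xor leb (proj₁ v) X) (X , b)
      (λ e → crossing-bottom-row X b (R⇒step e) (b≤y (proj₁ (R⇒inside e)))) P avoid)
    (parity-telescopes (λ w → leb (proj₁ w) X) P)
    where
    b≤y : ∀ {w} → InSquare a b t w → b ≤ proj₂ w
    b≤y (_ , _ , b≤y , _) = b≤y

  φ-left : ∀ Y → Avoids (a , Y) P → φ a Y ≡ (columnAbove a Y u₁ xor columnAbove a Y v₁)
  φ-left Y avoid = begin
    parity (crossing a Y) P
      ≡⟨ parity-cong _ _ (a , Y) (λ {u} {v} e _ _ → crossing-left-side a Y u v (a≤x (proj₁ (R⇒inside e))) (a≤x (proj₂ (R⇒inside e)))) P avoid ⟩
    parity (columnEntry a Y) P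
      ≡⟨ parity-cong _ _ (a , Y) (λ e → columnEntry-telescopes a Y (R⇒step e)) P avoid ⟩
    parity (λ u v → columnAbove a Y u xor columnAbove a Y v) P
      ≡⟨ parity-telescopes (columnAbove a Y) P ⟩
    columnAbove a Y u₁ xor columnAbove a Y v₁ ∎
    where
    open ≡-Reasoning
    a≤x : ∀ {w} → InSquare a b t w → a ≤ proj₁ w
    a≤x (a≤x , _) = a≤x

  φ-boundary : ∀ X Y → OnBoundary a b t (X , Y) → Avoids (X , Y) P
             → φ X Y ≡ (endCrossing (X , Y) u₁ xor endCrossing (X , Y) v₁)
  φ-boundary X Y (_ , inj₂ (inj₁ refl)) _ =
    trans (φ-right Y) (sym (cong₂ _xor_ (endCrossing-right Y _ _) (endCrossing-right Y _ _)))
  φ-boundary X Y (_ , inj₂ (inj₂ (inj₂ refl))) _ =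
    trans (φ-top X) (sym (cong₂ _xor_ (endCrossing-top X _ _ (q≤bt (proj₁ u₁∈∂))) (endCrossing-top X _ _ (q≤bt (proj₁ v₁∈∂)))))
    where
    q≤bt : ∀ {w} → InSquare a b t w → proj₂ w ≤ bt
    q≤bt (_ , _ , _ , q≤bt) = q≤bt
  φ-boundary X Y ((_ , X≤at , _ , _) , inj₂ (inj₂ (inj₁ refl))) avoid with X ≟ at
  ... | yes refl = trans (φ-right Y) (sym (cong₂ _xor_ (endCrossing-right Y _ _) (endCrossing-right Y _ _)))
  ... | no X≢at  = trans (φ-bottom X avoid)
                         (sym (cong₂ _xor_ (endCrossing-bottom X _ _ X<at) (endCrossing-bottom X _ _ X<at)))
    where X<at = ≤∧≢⇒< X≤at X≢at
  φ-boundary X Y ((_ , _ , b≤Y , _) , inj₁ refl) avoid with Y ≟ b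
  ... | yes refl = trans (φ-bottom a avoid) (sym (cong₂ _xor_ (endCrossing-bottom a _ _ a<at) (endCrossing-bottom a _ _ a<at)))
  ... | no Y≢b   = trans (φ-left Y avoid) (sym (cong₂ _xor_ (endCrossing-left Y _ _ b<Y) (endCrossing-left Y _ _ b<Y)))
    where b<Y = ≤∧≢⇒< b≤Y (Y≢b ∘ sym)

  ψ-boundary : ∀ z → OnBoundary a b t z → Avoids z P → ψ z ≡ (boundaryParity z u₁ xor boundaryParity z v₁)
  ψ-boundary (X , Y) z∈∂ avoid
    rewrite eqV-false (X , Y) u₁ (avoids-start _ P avoid ∘ sym) | eqV-false (X , Y) v₁ (avoids-end _ P avoid ∘ sym)
          | xor-identityʳ (endCrossing (X , Y) u₁ xor outerArc u₁ (X , Y))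
          | xor-identityʳ (endCrossing (X , Y) v₁ xor outerArc v₁ (X , Y))
          | φ-boundary X Y z∈∂ avoid
          = xor-interchange (endCrossing (X , Y) u₁) (endCrossing (X , Y) v₁) (outerArc u₁ (X , Y)) (outerArc v₁ (X , Y))

strictly-between⇒leb-differ : ∀ p q r → q ⊓ r < p → p < q ⊔ r → leb p q ≢ leb p r
strictly-between⇒leb-differ p q r lo hi with ≤-total q r
... | inj₁ q≤r rewrite m≤n⇒m⊓n≡m q≤r | m≤n⇒m⊔n≡n q≤r | leb-false lo | leb-true (<⇒≤ hi) = λ ()
... | inj₂ r≤q rewrite m≥n⇒m⊓n≡n r≤q | m≥n⇒m⊔n≡m r≤q | leb-false lo | leb-true (<⇒≤ hi) = λ ()

interleaved-paths-meet :
    (a b t : ℕ) → 0 < t → (R : V → V → Set)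
  → (∀ {u v} → R u v → UnitStep u v)
  → (∀ {u v} → R u v → InSquare a b t u × InSquare a b t v)
  → ∀ {u₁ v₁ u₂ v₂} → OnBoundary a b t u₁ → OnBoundary a b t v₁ → OnBoundary a b t u₂ → OnBoundary a b t v₂
  → ∀ p q r → Exp a b t u₁ v₁ p → Exp a b t u₁ u₂ q → Exp a b t u₁ v₂ r → q ⊓ r < p → p < q ⊔ r
  → (P : Star R u₁ v₁) (Q : Star R u₂ v₂) → ¬ PathVertices.Disjoint R Q P
interleaved-paths-meet a b t t>0 R R⇒step R⇒inside {u₁} {v₁} {u₂} {v₂} u₁∈∂ v₁∈∂ u₂∈∂ v₂∈∂
                       p q r exp-v₁ exp-u₂ exp-v₂ lo hi P Q disjoint =
  strictly-between⇒leb-differ p q r lo hi (xor-cancelˡ (Ψ u₁) _ _ (begin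
    Ψ u₁ xor leb p q ≡⟨ walk-parity-to u₂ q exp-u₂ ⟨
    Ψ u₂             ≡⟨ ψ-boundary u₂ u₂∈∂ (disjoint-start Q P disjoint) ⟨
    ψ u₂             ≡⟨ ψ-path Q disjoint ⟩
    ψ v₂             ≡⟨ ψ-boundary v₂ v₂∈∂ (disjoint-end Q P disjoint) ⟩
    Ψ v₂             ≡⟨ walk-parity-to v₂ r exp-v₂ ⟩
    Ψ u₁ xor leb p r ∎))
  where
  open ≡-Reasoning
  open PathVertices R
  open BoundaryWalk a b t t>0 u₁ v₁ u₁∈∂ v₁∈∂
  open Winding a b t t>0 R R⇒step R⇒inside u₁ v₁ P u₁∈∂ v₁∈∂

  p≥1 : 1 ≤ p
  p≥1 = ≤-<-trans z≤n lo

  walk-parity-to : ∀ y m → Exp a b t u₁ y m → Ψ y ≡ (Ψ u₁ xor leb p m)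
  walk-parity-to y m exp-y = FromU₁.walk-parity p p≥1 exp-v₁ m y exp-y m ≤-refl (proj₁ exp-y)

admissible⇒t>0 : ∀ m s t → Admissible m s t → 0 < t
admissible⇒t>0 m s t (_ , inj₁ (_ , refl))  = z<s
admissible⇒t>0 m s t (_ , inj₂ (_ , 2≤t)) = <-trans z<s 2≤t

subEdge⇒step : ∀ {m} (G : GridGraph m) t i j {u v} → SubEdge G t i j u v → UnitStep u v
subEdge⇒step G t i j {u} {v} (e , _) = manhattan≡1⇒step u v (proj₂ (proj₂ (wf G e)))

subEdge⇒inside : ∀ {m} (G : GridGraph m) t i j {u v} → SubEdge G t i j u v
               → InSquare (cornerX t i) (cornerX t j) t u × InSquare (cornerX t i) (cornerX t j) t v
subEdge⇒inside G t i j (_ , u∈□ , v∈□) = u∈□ , v∈□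

lemma2 : (m s t : ℕ) → Admissible m s t → (G : GridGraph m)
       → (i j : ℕ) → 1 ≤ i → i ≤ s → 1 ≤ j → j ≤ s
       → (u₁ v₁ u₂ v₂ : V)
       → BlockEdge G t i j u₁ v₁ → BlockEdge G t i j u₂ v₂
       → Cross t i j (u₁ , v₁) (u₂ , v₂)
       → AuxEdge G s t u₁ v₂ × AuxEdge G s t u₂ v₁
lemma2 m s t adm G i j 1≤i i≤s 1≤j j≤s u₁ v₁ u₂ v₂ (u₁∈∂ , v₁∈∂ , P) (u₂∈∂ , v₂∈∂ , Q)
       (_ , p , q , r , exp-v₁ , exp-u₂ , exp-v₂ , lo , hi) =
  block-edge u₁∈∂ v₂∈∂ (proj₁ spliced) , block-edge u₂∈∂ v₁∈∂ (proj₂ spliced)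
  where
  a b : ℕ
  a = cornerX t i
  b = cornerX t j

  spliced : Star (SubEdge G t i j) u₁ v₂ × Star (SubEdge G t i j) u₂ v₁
  spliced = PathVertices.splice (SubEdge G t i j) P Q
              (interleaved-paths-meet a b t (admissible⇒t>0 m s t adm) (SubEdge G t i j)
                 (subEdge⇒step G t i j) (subEdge⇒inside G t i j) u₁∈∂ v₁∈∂ u₂∈∂ v₂∈∂
                 p q r exp-v₁ exp-u₂ exp-v₂ lo hi P Q)

  block-edge : ∀ {u v} → OnBoundary a b t u → OnBoundary a b t v → PathIn G t i j u v → AuxEdge G s t u v
  block-edge u∈∂ v∈∂ path = i , j , 1≤i , i≤s , 1≤j , j≤s , u∈∂ , v∈∂ , path
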